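{- Let $f(X,Y)$ be a binary form of degree $n$ with integer coefficients and nonzero $X^n$-coefficient, let $m$ be a positive integer, and suppose $f$ is weakly divisible by $m$ at $a\in\mathbb{Z}$ and at $b\in\mathbb{Z}$. Then $$R'_{(f_a,m)}=R'_{(f_b,m)}\iff a\equiv b\pmod m.$$
   Context: Let $K=\mathbb{Q}[X]/(f(X,1))$ and $\delta$ the image of $X$. For $l\in\mathbb{Z}$, $f_l(x,y):=f(x+ly,y)$, so $f_l(X,1)$ has the root $\delta-l$ in $K$; all rings below are regarded as subsets of $K$ via this identification. For a binary form $g(X,Y)=c_nX^n+\cdots+c_0Y^n$ with integer coefficients, $c_n\ne0$, and a chosen root $\theta\in K$ of $g(X,1)$, the canonical basis is $B_0=1$, $B_k=c_n\theta^k+c_{n-1}\theta^{k-1}+\cdots+c_{n-k+1}\theta+c_{n-k}$ ($1\le k\le n-1$), and $R'_{(g,m)}$ is the $\mathbb{Z}$-span of $B_0,\dots,B_{n-2},\frac{B_{n-1}}{m}$ (using $\theta=\delta-l$ for $g=f_l$). A binary form $f$ is weakly divisible by $m$ at $l$ if $f(l,1)\equiv0\pmod{m^2}$ and $\frac{\partial f}{\partial x}(l,1)\equiv 0\pmod m$. -}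

module Defs where

open import Data.Nat as ℕ using (ℕ; zero; suc; _∸_)
open import Data.Nat.Combinatorics using (_C_)
open import Data.Integer as ℤ using (ℤ; +_; -[1+_])
open import Data.Integer.Divisibility using (_∣_)
open import Data.Rational as ℚ using (ℚ)
open import Data.Vec using (Vec; []; _∷_; zipWith; map; replicate; init; last; lookup; tabulate)
open import Data.Fin using (Fin; toℕ)
open import Data.Product using (Σ; _×_)
open import Relation.Binary.PropositionalEquality using (_≡_)
open import Relation.Nullary using (yes; no)

∑ℤ : ℕ → (ℕ → ℤ) → ℤ
∑ℤ zero    F = ℤ.0ℤ
∑ℤ (suc k) F = ∑ℤ k F ℤ.+ F k

-- Binary forms of degree n with integer coefficients.
-- f : BinForm n is the coefficient vector (c₀,…,cₙ), representing
--   f(X,Y) = Σ_{i=0}^{n} cᵢ X^i Y^(n-i).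

BinForm : ℕ → Set
BinForm n = Vec ℤ (suc n)

coeff : ∀ {k} → Vec ℤ k → ℕ → ℤ
coeff []       _       = ℤ.0ℤ
coeff (c ∷ cs) zero    = c
coeff (c ∷ cs) (suc i) = coeff cs i

evalAt1 : ∀ {n} → BinForm n → ℤ → ℤ
evalAt1 {n} f l = ∑ℤ (suc n) (λ i → coeff f i ℤ.* (l ℤ.^ i))

dxAt1 : ∀ {n} → BinForm n → ℤ → ℤ
dxAt1 {n} f l = ∑ℤ (suc n) (λ i → (+ i) ℤ.* coeff f i ℤ.* (l ℤ.^ (i ∸ 1)))

-- f_l(x,y) := f(x + l y, y); coefficient of x^j y^(n-j) is
--   Σ_{i} cᵢ (i choose j) l^(i-j)   (binomial expansion of (x+ly)^i)
shiftForm : ∀ {n} → ℤ → BinForm n → BinForm n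
shiftForm {n} l f =
  tabulate (λ (j : Fin (suc n)) →
    ∑ℤ (suc n) (λ i → coeff f i ℤ.* (+ (i C toℕ j)) ℤ.* (l ℤ.^ (i ∸ toℕ j))))

WeaklyDivisible : ∀ {n} → BinForm n → ℕ → ℤ → Set
WeaklyDivisible f m l =
  (+ (m ℕ.* m) ∣ evalAt1 f l) × (+ m ∣ dxAt1 f l)

-- The algebra K = ℚ[X]/(f(X,1)), f of degree n with cₙ ≠ 0.
-- An element of K is represented by its (unique) coordinate vector
-- (a₀,…,a_{n-1}) w.r.t. the ℚ-basis 1, δ, …, δ^(n-1), i.e. Σ aᵢ δ^i.

K : ℕ → Set
K n = Vec ℚ n

fromℤ : ℤ → ℚ
fromℤ z = z ℚ./ 1

-- 1/z in ℚ (value at 0 is irrelevant: only used for cₙ ≠ 0)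
recipℤ : ℤ → ℚ
recipℤ (+ zero)  = ℚ.0ℚ
recipℤ (+ suc k) = (+ 1) ℚ./ suc k
recipℤ -[1+ k ]  = -[1+ 0 ] ℚ./ suc k

-- 1/m in ℚ (value at 0 is irrelevant: only used for m > 0)
recipℕ : ℕ → ℚ
recipℕ m = recipℤ (+ m)

_⊕_ : ∀ {n} → K n → K n → K n
_⊕_ = zipWith ℚ._+_

_⊙_ : ∀ {n} → ℚ → K n → K n
q ⊙ v = map (q ℚ.*_) v

zeroK : ∀ {n} → K n
zeroK = replicate _ ℚ.0ℚ

oneK : ∀ {n} → K n
oneK {zero}  = []
oneK {suc n} = ℚ.1ℚ ∷ replicate _ ℚ.0ℚ

∑K : ∀ {n} → ℕ → (ℕ → K n) → K n
∑K zero    F = zeroK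
∑K (suc k) F = ∑K k F ⊕ F k

-- multiplication by δ in K = ℚ[X]/(f(X,1)):
--   δ · Σ aᵢ δ^i = Σ_{i<n-1} aᵢ δ^(i+1) + a_{n-1} δ^n,
--   δ^n = -(1/cₙ) Σ_{i<n} cᵢ δ^i.
mulδ : ∀ {n} → BinForm n → K n → K n
mulδ {zero}  f v = v
mulδ {suc n} f v =
  (ℚ.0ℚ ∷ init v) ⊕
  ((ℚ.- (last v ℚ.* recipℤ (coeff f (suc n)))) ⊙
     tabulate (λ (i : Fin (suc n)) → fromℤ (coeff f (toℕ i))))

mulθ : ∀ {n} → BinForm n → ℤ → K n → K n
mulθ f l v = mulδ f v ⊕ (fromℤ (ℤ.- l) ⊙ v)

θpow : ∀ {n} → BinForm n → ℤ → ℕ → K n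
θpow f l zero    = oneK
θpow f l (suc j) = mulθ f l (θpow f l j)

-- Canonical basis of g = f_l with root θ = δ - l of g(X,1):
--   B₀ = 1,  B_k = Σ_{j=0}^{k} g_{n-k+j} θ^j   (1 ≤ k ≤ n-1)
basisB : ∀ {n} → BinForm n → ℤ → ℕ → K n
basisB f l zero = oneK
basisB {n} f l (suc k') =
  ∑K (suc (suc k')) (λ j → fromℤ (coeff (shiftForm l f) ((n ∸ suc k') ℕ.+ j)) ⊙ θpow f l j)

-- generators of R'_{(f_l,m)}: B₀,…,B_{n-2}, B_{n-1}/m
genR' : ∀ {n} → BinForm n → ℤ → ℕ → ℕ → K n
genR' {n} f l m k with suc k ℕ.≟ n
... | yes _ = recipℕ m ⊙ basisB f l k
... | no  _ = basisB f l k

R' : ∀ {n} → BinForm n → ℤ → ℕ → K n → Set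
R' {n} f l m x = Σ (ℕ → ℤ) (λ z → x ≡ ∑K n (λ k → fromℤ (z k) ⊙ genR' f l m k))

-- Write θ = δ - l and g = f_l.  For 1 ≤ k ≤ n - 1 the basis element B_k = Σ_{j ≤ k} g_{n-k+j} θ^j is an
-- integer polynomial in δ of degree k with leading coefficient c_n, and B_{k+1} = θ B_k + g_{n-k-1}.
-- Together with Taylor's formula g^{a+t}_p = Σ_r C(p+r, r) t^r g^a_{p+r} this recursion gives, by
-- induction on k,
--   B_k(a + t) = Σ_{u ≤ k} C(n-k-1+u, u) t^u B_{k-u}(a).
-- If m ∣ t, every term with u ≥ 1 lies in m R′_{(f_a,m)}, so all generators of R′_{(f_{a+t},m)} lie in
-- R′_{(f_a,m)}, and symmetry gives equality.  Conversely, if B_{n-1}(b)/m ∈ R′_{(f_a,m)}, comparing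
-- the coefficients of δ^{n-1} and δ^{n-2} gives (b - a) c_n ∈ m c_n ℤ; here n ≥ 3 ensures that the
-- generator of degree n - 2 is B_{n-2} and not B₀ = 1.  Weak divisibility is needed for R′ to be a
-- ring, but not for this criterion.

module Submission where

open import Defs

open import Data.Empty using (⊥-elim)
open import Data.Fin as Fin using (Fin; toℕ; fromℕ; inject₁)
import Data.Fin.Properties as FP
open import Data.Integer as ℤ using (ℤ; +_; 0ℤ; 1ℤ; _+_; _*_; -_; _-_; _^_)
open import Data.Integer.Divisibility using (_∣_)
import Data.Integer.Divisibility.Signed as Sg
import Data.Integer.Properties as ℤP
open import Data.Integer.Tactic.RingSolver using (solve-∀)
open import Data.Nat as ℕ using (ℕ; zero; suc; _∸_; _!; z≤n; s≤s; _≤_; _<_)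
open import Data.Nat.Combinatorics
  using (_C_; nCn≡1; nC1≡n; nCk≡nC[n∸k]; nCk+nC[k+1]≡[n+1]C[k+1]; k![n∸k]!∣n!)
open import Data.Nat.Combinatorics.Specification using (nCk≡n!/k![n-k]!; k>n⇒nCk≡0)
import Data.Nat.Coprimality as Cop
import Data.Nat.DivMod as ℕD
import Data.Nat.Divisibility as ℕᵈ
import Data.Nat.Properties as ℕP
import Data.Nat.Tactic.RingSolver as ℕSolver
open import Data.Product using (Σ; _×_; _,_)
open import Data.Rational as ℚ using (ℚ; mkℚ)
import Data.Rational.Properties as ℚP
open import Data.Sum using (inj₁; inj₂)
open import Data.Vec using (Vec; []; _∷_; init; last; lookup; tabulate)
import Data.Vec.Properties as VP
open import Function using (_∘_)
open import Function.Bundles using (_⇔_; mk⇔)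
open import Relation.Binary.PropositionalEquality
open import Relation.Nullary using (yes; no)
open import Relation.Unary using (_≐_)
open import Algebra.Properties.CommutativeSemiring.Binomial ℤP.+-*-commutativeSemiring as Binomial
  using (binomialExpansion)
open import Algebra.Properties.Monoid.Sum ℤP.+-0-monoid using (sum; sum-cong-≗)
import Algebra.Properties.Semiring.Exp ℤP.+-*-semiring as Exp
open import Algebra.Definitions.RawMonoid ℤ.+-0-rawMonoid using () renaming (_×_ to _×ᵐ_)

∑-cong : ∀ N {F G : ℕ → ℤ} → (∀ j → j ℕ.< N → F j ≡ G j) → ∑ℤ N F ≡ ∑ℤ N G
∑-cong zero    F≡G = refl
∑-cong (suc N) F≡G = cong₂ _+_ (∑-cong N (λ j j<N → F≡G j (ℕP.m<n⇒m<1+n j<N))) (F≡G N ℕP.≤-refl)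

∑-zero : ∀ N {F : ℕ → ℤ} → (∀ j → j ℕ.< N → F j ≡ 0ℤ) → ∑ℤ N F ≡ 0ℤ
∑-zero N F≡0 = trans (∑-cong N F≡0) (∑0 N)
  where ∑0 : ∀ N → ∑ℤ N (λ _ → 0ℤ) ≡ 0ℤ
        ∑0 zero    = refl
        ∑0 (suc N) = cong (_+ 0ℤ) (∑0 N)

∑-distrib-+ : ∀ N (F G : ℕ → ℤ) → ∑ℤ N (λ j → F j + G j) ≡ ∑ℤ N F + ∑ℤ N G
∑-distrib-+ zero    F G = refl
∑-distrib-+ (suc N) F G rewrite ∑-distrib-+ N F G = middle-swap (∑ℤ N F) (∑ℤ N G) (F N) (G N)
  where middle-swap : ∀ a b c d → a + b + (c + d) ≡ a + c + (b + d)
        middle-swap = solve-∀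

∑-*ˡ : ∀ N c (F : ℕ → ℤ) → ∑ℤ N (λ j → c * F j) ≡ c * ∑ℤ N F
∑-*ˡ zero    c F = sym (ℤP.*-zeroʳ c)
∑-*ˡ (suc N) c F rewrite ∑-*ˡ N c F = sym (ℤP.*-distribˡ-+ c (∑ℤ N F) (F N))

∑-distrib-- : ∀ N (F G : ℕ → ℤ) → ∑ℤ N (λ j → F j - G j) ≡ ∑ℤ N F - ∑ℤ N G
∑-distrib-- zero    F G = refl
∑-distrib-- (suc N) F G rewrite ∑-distrib-- N F G = middle-swap (∑ℤ N F) (∑ℤ N G) (F N) (G N)
  where middle-swap : ∀ a b c d → a - b + (c - d) ≡ a + c - (b + d)
        middle-swap = solve-∀

∑-*ʳ : ∀ N (F : ℕ → ℤ) c → ∑ℤ N (λ j → F j * c) ≡ ∑ℤ N F * c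
∑-*ʳ N F c = begin
  ∑ℤ N (λ j → F j * c) ≡⟨ ∑-cong N (λ j _ → ℤP.*-comm (F j) c) ⟩
  ∑ℤ N (λ j → c * F j) ≡⟨ ∑-*ˡ N c F ⟩
  c * ∑ℤ N F           ≡⟨ ℤP.*-comm c _ ⟩
  ∑ℤ N F * c           ∎
  where open ≡-Reasoning

∑-head : ∀ N (F : ℕ → ℤ) → ∑ℤ (suc N) F ≡ F 0 + ∑ℤ N (λ j → F (suc j))
∑-head zero    F = trans (ℤP.+-identityˡ (F 0)) (sym (ℤP.+-identityʳ (F 0)))
∑-head (suc N) F rewrite ∑-head N F = ℤP.+-assoc (F 0) _ _

∑-comm : ∀ N M (F : ℕ → ℕ → ℤ) → ∑ℤ N (λ i → ∑ℤ M (F i)) ≡ ∑ℤ M (λ j → ∑ℤ N (λ i → F i j))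
∑-comm zero    M F = sym (∑-zero M (λ _ _ → refl))
∑-comm (suc N) M F rewrite ∑-comm N M F = sym (∑-distrib-+ M (λ j → ∑ℤ N (λ i → F i j)) (F N))

∑-dropZeros : ∀ N K (F : ℕ → ℤ) → (∀ j → N ℕ.≤ j → F j ≡ 0ℤ) → ∑ℤ (N ℕ.+ K) F ≡ ∑ℤ N F
∑-dropZeros N zero    F F≡0 = cong (λ M → ∑ℤ M F) (ℕP.+-identityʳ N)
∑-dropZeros N (suc K) F F≡0 rewrite ℕP.+-suc N K | F≡0 (N ℕ.+ K) (ℕP.m≤m+n N K) =
  trans (ℤP.+-identityʳ _) (∑-dropZeros N K F F≡0)

∑-single : ∀ N k (F : ℕ → ℤ) → k ℕ.< N → (∀ j → j ≢ k → F j ≡ 0ℤ) → ∑ℤ N F ≡ F k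
∑-single (suc N) k F k<1+N F≡0 with k ℕP.≟ N
... | yes refl = trans (cong (_+ F k) (∑-zero k (λ j j<k → F≡0 j (ℕP.<⇒≢ j<k)))) (ℤP.+-identityˡ (F k))
... | no  k≢N  = trans (cong₂ _+_ (∑-single N k F k<N F≡0) (F≡0 N (k≢N ∘ sym))) (ℤP.+-identityʳ (F k))
  where k<N = ℕP.≤∧≢⇒< (ℕP.≤-pred k<1+N) k≢N

∑≡sum : ∀ N (F : ℕ → ℤ) → ∑ℤ N F ≡ sum (λ (i : Fin N) → F (toℕ i))
∑≡sum zero    F = refl
∑≡sum (suc N) F = trans (∑-head N F) (cong (λ s → F 0 + s) (∑≡sum N (λ j → F (suc j))))

×≡* : ∀ k x → k ×ᵐ x ≡ + k * x
×≡* zero    x = sym (ℤP.*-zeroˡ x)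
×≡* (suc k) x = trans (cong (λ s → x + s) (×≡* k x)) (sym (trans (cong (_* x) (ℤP.pos-+ 1 k)) (distrib (+ k) x)))
  where distrib : ∀ k x → (1ℤ + k) * x ≡ x + k * x
        distrib = solve-∀

^≡^ : ∀ x k → x Exp.^ k ≡ x ^ k
^≡^ x zero    = refl
^≡^ x (suc k) = cong (x *_) (^≡^ x k)

binomial-theorem : ∀ e (a t : ℤ) → (a + t) ^ e ≡ ∑ℤ (suc e) (λ r → + (e C r) * (t ^ r * a ^ (e ∸ r)))
binomial-theorem e a t = begin
  (a + t) ^ e                  ≡⟨ cong (_^ e) (ℤP.+-comm a t) ⟩
  (t + a) ^ e                  ≡⟨ sym (^≡^ (t + a) e) ⟩
  (t + a) Exp.^ e              ≡⟨ Binomial.theorem e t a ⟩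
  binomialExpansion t a e      ≡⟨ sum-cong-≗ {suc e} term ⟩
  sum (λ (r : Fin (suc e)) → T (toℕ r)) ≡⟨ sym (∑≡sum (suc e) T) ⟩
  ∑ℤ (suc e) (λ r → + (e C r) * (t ^ r * a ^ (e ∸ r))) ∎
  where
  open ≡-Reasoning
  T : ℕ → ℤ
  T r = + (e C r) * (t ^ r * a ^ (e ∸ r))
  term : ∀ r → (e C toℕ r) ×ᵐ (t Exp.^ toℕ r * a Exp.^ (e ∸ toℕ r)) ≡ T (toℕ r)
  term r = trans (×≡* (e C toℕ r) (t Exp.^ toℕ r * a Exp.^ (e ∸ toℕ r))) (cong (+ (e C toℕ r) *_) (cong₂ _*_ (^≡^ t (toℕ r)) (^≡^ a (e ∸ toℕ r))))

nCk*[k!*[n∸k]!]≡n! : ∀ {N k} → k ℕ.≤ N → (N C k) ℕ.* (k ! ℕ.* (N ∸ k) !) ≡ N !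
nCk*[k!*[n∸k]!]≡n! {N} {k} k≤N =
  trans (cong (ℕ._* (k ! ℕ.* (N ∸ k) !)) (nCk≡n!/k![n-k]! k≤N))
        (ℕD.m/n*n≡m {{ℕP._!*_!≢0 k (N ∸ k)}} (k![n∸k]!∣n! k≤N))

[1+n]Cn≡1+n : ∀ n → suc n C n ≡ suc n
[1+n]Cn≡1+n n = trans (nCk≡nC[n∸k] (ℕP.n≤1+n n)) (trans (cong (suc n C_) (ℕP.m+n∸n≡m 1 n)) (nC1≡n (suc n)))

m∸n+o≡m∸[n∸o] : ∀ {N k u} → u ℕ.≤ k → k ℕ.≤ N → N ∸ k ℕ.+ u ≡ N ∸ (k ∸ u)
m∸n+o≡m∸[n∸o] {N} {k} {u} u≤k k≤N = begin
  N ∸ k ℕ.+ u              ≡⟨ cong (λ x → N ∸ x ℕ.+ u) (sym k≡d+u) ⟩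
  N ∸ (d ℕ.+ u) ℕ.+ u      ≡⟨ cong (ℕ._+ u) (sym (ℕP.∸-+-assoc N d u)) ⟩
  N ∸ d ∸ u ℕ.+ u          ≡⟨ ℕP.m∸n+n≡m u≤N∸d ⟩
  N ∸ d                    ∎
  where
  open ≡-Reasoning
  d = k ∸ u
  k≡d+u : d ℕ.+ u ≡ k
  k≡d+u = ℕP.m∸n+n≡m u≤k
  u≤N∸d : u ℕ.≤ N ∸ d
  u≤N∸d = ℕP.m+n≤o⇒m≤o∸n u (subst (ℕ._≤ N) (trans (sym k≡d+u) (ℕP.+-comm d u)) k≤N)

-- Both sides times p! r! (e ∸ r)! are (p + e)!.
[p+r]Cr*[p+e]C[p+r]≡[p+e]Cp*eCr : ∀ p r e → r ℕ.≤ e →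
  ((p ℕ.+ r) C r) ℕ.* ((p ℕ.+ e) C (p ℕ.+ r)) ≡ ((p ℕ.+ e) C p) ℕ.* (e C r)
[p+r]Cr*[p+e]C[p+r]≡[p+e]Cp*eCr p r e r≤e = ℕP.*-cancelʳ-≡ _ _ (r ! ℕ.* p ! ℕ.* (e ∸ r) !) {{nonZero}} (trans lhs (sym rhs))
  where
  nonZero : ℕ.NonZero (r ! ℕ.* p ! ℕ.* (e ∸ r) !)
  nonZero = ℕP.m*n≢0 _ _ {{ℕP.m*n≢0 _ _ {{ℕP._!≢0 r}} {{ℕP._!≢0 p}}}} {{ℕP._!≢0 (e ∸ r)}}
  p+r : ((p ℕ.+ r) C r) ℕ.* (r ! ℕ.* p !) ≡ (p ℕ.+ r) !
  p+r = trans (cong (λ z → ((p ℕ.+ r) C r) ℕ.* (r ! ℕ.* z !)) (sym (ℕP.m+n∸n≡m p r)))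
              (nCk*[k!*[n∸k]!]≡n! (ℕP.m≤n+m r p))
  p+e₁ : ((p ℕ.+ e) C (p ℕ.+ r)) ℕ.* ((p ℕ.+ r) ! ℕ.* (e ∸ r) !) ≡ (p ℕ.+ e) !
  p+e₁ = trans (cong (λ z → ((p ℕ.+ e) C (p ℕ.+ r)) ℕ.* ((p ℕ.+ r) ! ℕ.* z !)) (sym (ℕP.[m+n]∸[m+o]≡n∸o p e r)))
               (nCk*[k!*[n∸k]!]≡n! (ℕP.+-monoʳ-≤ p r≤e))
  p+e₂ : ((p ℕ.+ e) C p) ℕ.* (p ! ℕ.* e !) ≡ (p ℕ.+ e) !
  p+e₂ = trans (cong (λ z → ((p ℕ.+ e) C p) ℕ.* (p ! ℕ.* z !)) (sym (ℕP.m+n∸m≡n p e)))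
               (nCk*[k!*[n∸k]!]≡n! (ℕP.m≤m+n p e))
  lhs : ((p ℕ.+ r) C r) ℕ.* ((p ℕ.+ e) C (p ℕ.+ r)) ℕ.* (r ! ℕ.* p ! ℕ.* (e ∸ r) !) ≡ (p ℕ.+ e) !
  lhs = trans (shuffle ((p ℕ.+ r) C r) ((p ℕ.+ e) C (p ℕ.+ r)) (r !) (p !) ((e ∸ r) !))
              (trans (cong (λ w → ((p ℕ.+ e) C (p ℕ.+ r)) ℕ.* (w ℕ.* (e ∸ r) !)) p+r) p+e₁)
    where shuffle : ∀ A B x y z → A ℕ.* B ℕ.* (x ℕ.* y ℕ.* z) ≡ B ℕ.* (A ℕ.* (x ℕ.* y) ℕ.* z)
          shuffle = ℕSolver.solve-∀
  rhs : ((p ℕ.+ e) C p) ℕ.* (e C r) ℕ.* (r ! ℕ.* p ! ℕ.* (e ∸ r) !) ≡ (p ℕ.+ e) !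
  rhs = trans (shuffle ((p ℕ.+ e) C p) (e C r) (r !) (p !) ((e ∸ r) !))
              (trans (cong (λ w → ((p ℕ.+ e) C p) ℕ.* (p ! ℕ.* w)) (nCk*[k!*[n∸k]!]≡n! r≤e)) p+e₂)
    where shuffle : ∀ A B x y z → A ℕ.* B ℕ.* (x ℕ.* y ℕ.* z) ≡ A ℕ.* (y ℕ.* (B ℕ.* (x ℕ.* z)))
          shuffle = ℕSolver.solve-∀

*0*≡0 : ∀ x {k} y → k ≡ 0 → x * + k * y ≡ 0ℤ
*0*≡0 x y refl = trans (cong (_* y) (ℤP.*-zeroʳ x)) (ℤP.*-zeroˡ y)

binomial-shift : ∀ a t p {i} n → i ℕ.≤ n →
  ∑ℤ (suc (n ∸ p)) (λ r → + ((p ℕ.+ r) C r) * + (i C (p ℕ.+ r)) * (t ^ r * a ^ (i ∸ (p ℕ.+ r))))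
    ≡ + (i C p) * (a + t) ^ (i ∸ p)
binomial-shift a t p {i} n i≤n with p ℕP.≤? i
... | no p≰i = trans (∑-zero (suc (n ∸ p)) (λ r _ → vanish r))
                    (sym (trans (cong (λ x → + x * (a + t) ^ (i ∸ p)) (k>n⇒nCk≡0 i<p)) (ℤP.*-zeroˡ ((a + t) ^ (i ∸ p)))))
  where
  i<p = ℕP.≰⇒> p≰i
  vanish : ∀ r → + ((p ℕ.+ r) C r) * + (i C (p ℕ.+ r)) * (t ^ r * a ^ (i ∸ (p ℕ.+ r))) ≡ 0ℤ
  vanish r = *0*≡0 (+ ((p ℕ.+ r) C r)) (t ^ r * a ^ (i ∸ (p ℕ.+ r))) (k>n⇒nCk≡0 (ℕP.<-≤-trans i<p (ℕP.m≤m+n p r)))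
... | yes p≤i with ℕP.m≤n⇒∃[o]m+o≡n p≤i | ℕP.m≤n⇒∃[o]m+o≡n i≤n
...   | e , refl | K , refl = begin
  ∑ℤ (suc ((p ℕ.+ e ℕ.+ K) ∸ p)) F   ≡⟨ cong (λ z → ∑ℤ (suc z) F) (trans (cong (_∸ p) (ℕP.+-assoc p e K)) (ℕP.m+n∸m≡n p (e ℕ.+ K))) ⟩
  ∑ℤ (suc e ℕ.+ K) F                 ≡⟨ ∑-dropZeros (suc e) K F vanish ⟩
  ∑ℤ (suc e) F                       ≡⟨ ∑-cong (suc e) (λ r r<1+e → term r (ℕP.≤-pred r<1+e)) ⟩
  ∑ℤ (suc e) (λ r → + ((p ℕ.+ e) C p) * (+ (e C r) * (t ^ r * a ^ (e ∸ r))))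
                                     ≡⟨ ∑-*ˡ (suc e) (+ ((p ℕ.+ e) C p)) (λ r → + (e C r) * (t ^ r * a ^ (e ∸ r))) ⟩
  + ((p ℕ.+ e) C p) * ∑ℤ (suc e) (λ r → + (e C r) * (t ^ r * a ^ (e ∸ r)))
                                     ≡⟨ cong (+ ((p ℕ.+ e) C p) *_) (sym (binomial-theorem e a t)) ⟩
  + ((p ℕ.+ e) C p) * (a + t) ^ e    ≡⟨ cong (λ z → + ((p ℕ.+ e) C p) * (a + t) ^ z) (sym (ℕP.m+n∸m≡n p e)) ⟩
  + ((p ℕ.+ e) C p) * (a + t) ^ ((p ℕ.+ e) ∸ p) ∎
  where
  open ≡-Reasoning
  F : ℕ → ℤ
  F r = + ((p ℕ.+ r) C r) * + ((p ℕ.+ e) C (p ℕ.+ r)) * (t ^ r * a ^ ((p ℕ.+ e) ∸ (p ℕ.+ r)))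
  vanish : ∀ r → suc e ℕ.≤ r → F r ≡ 0ℤ
  vanish r e<r = *0*≡0 (+ ((p ℕ.+ r) C r)) (t ^ r * a ^ ((p ℕ.+ e) ∸ (p ℕ.+ r))) (k>n⇒nCk≡0 (ℕP.+-monoʳ-< p e<r))
  term : ∀ r → r ℕ.≤ e → F r ≡ + ((p ℕ.+ e) C p) * (+ (e C r) * (t ^ r * a ^ (e ∸ r)))
  term r r≤e =
    trans (cong (λ z → + ((p ℕ.+ r) C r) * + ((p ℕ.+ e) C (p ℕ.+ r)) * (t ^ r * a ^ z)) (ℕP.[m+n]∸[m+o]≡n∸o p e r)) (trans (cong (_* (t ^ r * a ^ (e ∸ r))) (trans (sym (ℤP.pos-* ((p ℕ.+ r) C r) ((p ℕ.+ e) C (p ℕ.+ r))))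
            (trans (cong +_ ([p+r]Cr*[p+e]C[p+r]≡[p+e]Cp*eCr p r e r≤e)) (ℤP.pos-* ((p ℕ.+ e) C p) (e C r)))))
          (ℤP.*-assoc (+ ((p ℕ.+ e) C p)) (+ (e C r)) (t ^ r * a ^ (e ∸ r))))

-- Elements of ℤ[δ] are coefficient sequences; mulθᶻ l multiplies by θ = δ - l without reducing modulo f,
-- which agrees with multiplication in K as long as the degree stays below n.
oneᶻ : ℕ → ℤ
oneᶻ zero    = 1ℤ
oneᶻ (suc _) = 0ℤ

mulθᶻ : ℤ → (ℕ → ℤ) → ℕ → ℤ
mulθᶻ l P zero    = - l * P 0
mulθᶻ l P (suc i) = P i + - l * P (suc i)

θpowᶻ : ℤ → ℕ → ℕ → ℤ
θpowᶻ l zero    = oneᶻ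
θpowᶻ l (suc j) = mulθᶻ l (θpowᶻ l j)

mulθᶻ-cong : ∀ l {P Q : ℕ → ℤ} → P ≗ Q → mulθᶻ l P ≗ mulθᶻ l Q
mulθᶻ-cong l P≗Q zero    = cong (- l *_) (P≗Q 0)
mulθᶻ-cong l P≗Q (suc i) = cong₂ (λ x y → x + - l * y) (P≗Q i) (P≗Q (suc i))

mulθᶻ-∑ : ∀ l K (w : ℕ → ℤ) (P : ℕ → ℕ → ℤ) →
  mulθᶻ l (λ i → ∑ℤ K (λ j → w j * P j i)) ≗ λ i → ∑ℤ K (λ j → w j * mulθᶻ l (P j) i)
mulθᶻ-∑ l K w P zero = trans (sym (∑-*ˡ K (- l) _)) (∑-cong K (λ j _ → swap (- l) (w j) (P j 0)))
  where swap : ∀ x y z → x * (y * z) ≡ y * (x * z)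
        swap = solve-∀
mulθᶻ-∑ l K w P (suc i) =
  trans (cong (λ z → ∑ℤ K (λ j → w j * P j i) + z) (sym (∑-*ˡ K (- l) _)))
        (trans (sym (∑-distrib-+ K _ _)) (∑-cong K (λ j _ → collect (- l) (w j) (P j i) (P j (suc i)))))
  where collect : ∀ x y z v → y * z + x * (y * v) ≡ y * (z + x * v)
        collect = solve-∀

mulθᶻ-+ : ∀ a t (P : ℕ → ℤ) → mulθᶻ (a + t) P ≗ λ i → mulθᶻ a P i + - t * P i
mulθᶻ-+ a t P zero = expand a t (P 0)
  where expand : ∀ a t x → - (a + t) * x ≡ - a * x + - t * x
        expand = solve-∀
mulθᶻ-+ a t P (suc i) = expand a t (P i) (P (suc i))
  where expand : ∀ a t y x → y + - (a + t) * x ≡ y + - a * x + - t * x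
        expand = solve-∀

θpowᶻ-above : ∀ l j i → j ℕ.< i → θpowᶻ l j i ≡ 0ℤ
θpowᶻ-above l zero    (suc i) _ = refl
θpowᶻ-above l (suc j) (suc i) (s≤s j<i)
  rewrite θpowᶻ-above l j i j<i | θpowᶻ-above l j (suc i) (ℕP.m<n⇒m<1+n j<i) = cancel l
  where cancel : ∀ l → 0ℤ + - l * 0ℤ ≡ 0ℤ
        cancel = solve-∀

β : ℕ → ℕ → ℤ
β s u = + ((s ℕ.+ u) C u)

β-pascal : ∀ s u → β (suc s) (suc u) ≡ β (suc s) u + β s (suc u)
β-pascal s u rewrite ℕP.+-suc s u =
  sym (trans (sym (ℤP.pos-+ (suc (s ℕ.+ u) C u) (suc (s ℕ.+ u) C suc u)))
             (cong +_ (nCk+nC[k+1]≡[n+1]C[k+1] (suc (s ℕ.+ u)) u)))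

module _ (s k : ℕ) (t : ℤ) (P : ℕ → ℤ) where

  private
    W : ℕ → ℤ
    W u = β (suc s) u * t ^ u

    A : ℤ
    A = ∑ℤ (suc k) (λ u → W (suc u) * P (k ∸ u))

    advance : ∑ℤ (suc k) (λ u → W u * P (suc (k ∸ u))) + W (suc k) * P 0 ≡ P (suc k) + A
    advance = begin
      ∑ℤ (suc k) (λ u → W u * P (suc (k ∸ u))) + W (suc k) * P 0
        ≡⟨ cong₂ _+_ (∑-head k (λ u → W u * P (suc (k ∸ u)))) (cong (λ j → W (suc k) * P j) (sym (ℕP.n∸n≡0 k))) ⟩
      W 0 * P (suc k) + ∑ℤ k (λ u → W (suc u) * P (suc (k ∸ suc u))) + W (suc k) * P (k ∸ k)
        ≡⟨ cong (λ x → W 0 * P (suc k) + x + W (suc k) * P (k ∸ k))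
                (∑-cong k (λ u u<k → cong (λ j → W (suc u) * P j) (sym (ℕP.+-∸-assoc 1 u<k)))) ⟩
      W 0 * P (suc k) + ∑ℤ k (λ u → W (suc u) * P (k ∸ u)) + W (suc k) * P (k ∸ k)
        ≡⟨ ℤP.+-assoc (W 0 * P (suc k)) (∑ℤ k (λ u → W (suc u) * P (k ∸ u))) (W (suc k) * P (k ∸ k)) ⟩
      W 0 * P (suc k) + A
        ≡⟨ cong (_+ A) (ℤP.*-identityˡ (P (suc k))) ⟩
      P (suc k) + A ∎
      where open ≡-Reasoning

    pascal : ∑ℤ (suc k) (λ u → β s (suc u) * t ^ suc u * P (k ∸ u))
             ≡ A - t * ∑ℤ (suc k) (λ u → W u * P (k ∸ u))
    pascal = begin
      ∑ℤ (suc k) (λ u → β s (suc u) * t ^ suc u * P (k ∸ u))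
        ≡⟨ ∑-cong (suc k) (λ u _ → split u) ⟩
      ∑ℤ (suc k) (λ u → W (suc u) * P (k ∸ u) + - t * (W u * P (k ∸ u)))
        ≡⟨ ∑-distrib-+ (suc k) _ _ ⟩
      A + ∑ℤ (suc k) (λ u → - t * (W u * P (k ∸ u)))
        ≡⟨ cong (λ x → A + x) (trans (∑-*ˡ (suc k) (- t) _) (sym (ℤP.neg-distribˡ-* t _))) ⟩
      A - t * ∑ℤ (suc k) (λ u → W u * P (k ∸ u)) ∎
      where
      open ≡-Reasoning
      split : ∀ u → β s (suc u) * t ^ suc u * P (k ∸ u) ≡ W (suc u) * P (k ∸ u) + - t * (W u * P (k ∸ u))
      split u = trans (lemma (β (suc s) u) (β s (suc u)) t (t ^ u) (P (k ∸ u)))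
                      (cong (λ b → b * t ^ suc u * P (k ∸ u) + - t * (W u * P (k ∸ u))) (sym (β-pascal s u)))
        where lemma : ∀ b b′ t T x → b′ * (t * T) * x ≡ (b + b′) * (t * T) * x + - t * (b * T * x)
              lemma = solve-∀

  -- The combinatorial core of the induction step in Bᶻ-shift: Pascal's rule for β, summed against P.
  pascal-convolution :
    ∑ℤ (suc k) (λ u → β (suc s) u * t ^ u * P (suc (k ∸ u)))
      - t * ∑ℤ (suc k) (λ u → β (suc s) u * t ^ u * P (k ∸ u))
      + β (suc s) (suc k) * t ^ suc k * P 0
    ≡ ∑ℤ (suc (suc k)) (λ u → β s u * t ^ u * P (suc k ∸ u))
  pascal-convolution = begin
    S₊ - t * S + W (suc k) * P 0          ≡⟨ swap S₊ (t * S) (W (suc k) * P 0) ⟩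
    S₊ + W (suc k) * P 0 - t * S          ≡⟨ cong (_- t * S) advance ⟩
    P (suc k) + A - t * S                 ≡⟨ ℤP.+-assoc (P (suc k)) A (- (t * S)) ⟩
    P (suc k) + (A - t * S)               ≡⟨ cong₂ _+_ (sym (ℤP.*-identityˡ (P (suc k)))) (sym pascal) ⟩
    β s 0 * t ^ 0 * P (suc k) + ∑ℤ (suc k) (λ u → β s (suc u) * t ^ suc u * P (k ∸ u))
                                          ≡⟨ sym (∑-head (suc k) (λ u → β s u * t ^ u * P (suc k ∸ u))) ⟩
    ∑ℤ (suc (suc k)) (λ u → β s u * t ^ u * P (suc k ∸ u)) ∎
    where
    open ≡-Reasoning
    S₊ = ∑ℤ (suc k) (λ u → W u * P (suc (k ∸ u)))
    S  = ∑ℤ (suc k) (λ u → W u * P (k ∸ u))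
    swap : ∀ x y z → x - y + z ≡ x + z - y
    swap = solve-∀

module Polynomials {N : ℕ} (f : BinForm (suc N)) where

  n : ℕ
  n = suc N

  shiftCoeff : ℤ → ℕ → ℤ
  shiftCoeff l p = ∑ℤ (suc n) (λ i → coeff f i * + (i C p) * l ^ (i ∸ p))

  private
    lowTerms : ∀ l p → ∑ℤ p (λ i → coeff f i * + (i C p) * l ^ (i ∸ p)) ≡ 0ℤ
    lowTerms l p = ∑-zero p (λ i i<p → *0*≡0 (coeff f i) (l ^ (i ∸ p)) (k>n⇒nCk≡0 i<p))

  shiftCoeff-above : ∀ l p → n ℕ.< p → shiftCoeff l p ≡ 0ℤ
  shiftCoeff-above l p n<p =
    ∑-zero (suc n) (λ i i≤n → *0*≡0 (coeff f i) (l ^ (i ∸ p)) (k>n⇒nCk≡0 (ℕP.<-≤-trans i≤n n<p)))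

  shiftCoeff-top : ∀ l → shiftCoeff l n ≡ coeff f n
  shiftCoeff-top l rewrite lowTerms l n | nCn≡1 n | ℕP.n∸n≡0 n = lemma (coeff f n)
    where lemma : ∀ x → 0ℤ + x * 1ℤ * 1ℤ ≡ x
          lemma = solve-∀

  shiftCoeff-subtop : ∀ l → shiftCoeff l N ≡ coeff f N + + n * l * coeff f n
  shiftCoeff-subtop l rewrite lowTerms l N | nCn≡1 N | ℕP.n∸n≡0 N | [1+n]Cn≡1+n N | ℕP.m+n∸n≡m 1 N =
    lemma (coeff f N) (coeff f n) (+ n) l
    where
    lemma : ∀ x y m l → 0ℤ + x * 1ℤ * 1ℤ + y * m * (l * 1ℤ) ≡ x + m * l * y
    lemma = solve-∀

  shiftCoeff-+ : ∀ a t p →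
    shiftCoeff (a + t) p ≡ ∑ℤ (suc (n ∸ p)) (λ r → + ((p ℕ.+ r) C r) * t ^ r * shiftCoeff a (p ℕ.+ r))
  shiftCoeff-+ a t p = sym (begin
    ∑ℤ (suc (n ∸ p)) (λ r → + ((p ℕ.+ r) C r) * t ^ r * shiftCoeff a (p ℕ.+ r))
      ≡⟨ ∑-cong (suc (n ∸ p)) (λ r _ → sym (∑-*ˡ (suc n) (+ ((p ℕ.+ r) C r) * t ^ r) (G (p ℕ.+ r)))) ⟩
    ∑ℤ (suc (n ∸ p)) (λ r → ∑ℤ (suc n) (F r))
      ≡⟨ ∑-comm (suc (n ∸ p)) (suc n) F ⟩
    ∑ℤ (suc n) (λ i → ∑ℤ (suc (n ∸ p)) (λ r → F r i))
      ≡⟨ ∑-cong (suc n) (λ i i<1+n → inner i (ℕP.≤-pred i<1+n)) ⟩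
    ∑ℤ (suc n) (λ i → coeff f i * (+ (i C p) * (a + t) ^ (i ∸ p)))
      ≡⟨ ∑-cong (suc n) (λ i _ → sym (ℤP.*-assoc (coeff f i) (+ (i C p)) ((a + t) ^ (i ∸ p)))) ⟩
    shiftCoeff (a + t) p ∎)
    where
    open ≡-Reasoning
    G : ℕ → ℕ → ℤ
    G q i = coeff f i * + (i C q) * a ^ (i ∸ q)
    F : ℕ → ℕ → ℤ
    F r i = + ((p ℕ.+ r) C r) * t ^ r * G (p ℕ.+ r) i
    H : ℕ → ℕ → ℤ
    H i r = + ((p ℕ.+ r) C r) * + (i C (p ℕ.+ r)) * (t ^ r * a ^ (i ∸ (p ℕ.+ r)))
    inner : ∀ i → i ℕ.≤ n → ∑ℤ (suc (n ∸ p)) (λ r → F r i) ≡ coeff f i * (+ (i C p) * (a + t) ^ (i ∸ p))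
    inner i i≤n = begin
      ∑ℤ (suc (n ∸ p)) (λ r → F r i)
        ≡⟨ ∑-cong (suc (n ∸ p)) (λ r _ → rearrange (+ ((p ℕ.+ r) C r)) (t ^ r) (coeff f i) (+ (i C (p ℕ.+ r))) (a ^ (i ∸ (p ℕ.+ r)))) ⟩
      ∑ℤ (suc (n ∸ p)) (λ r → coeff f i * H i r)
        ≡⟨ ∑-*ˡ (suc (n ∸ p)) (coeff f i) (H i) ⟩
      coeff f i * ∑ℤ (suc (n ∸ p)) (H i)
        ≡⟨ cong (coeff f i *_) (binomial-shift a t p n i≤n) ⟩
      coeff f i * (+ (i C p) * (a + t) ^ (i ∸ p)) ∎
      where rearrange : ∀ x y u v w → x * y * (u * v * w) ≡ u * (x * v * (y * w))
            rearrange = solve-∀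

  -- Bᶻ l k is B_k for k ≥ 1; for k = 0 the same formula gives c_n rather than B₀ = 1 (see basisᶻ).
  Bᶻ : ℤ → ℕ → ℕ → ℤ
  Bᶻ l k i = ∑ℤ (suc k) (λ j → shiftCoeff l (n ∸ k ℕ.+ j) * θpowᶻ l j i)

  Bᶻ-zero : ∀ l → Bᶻ l 0 ≗ λ i → coeff f n * oneᶻ i
  Bᶻ-zero l i = trans (ℤP.+-identityˡ (shiftCoeff l (n ℕ.+ 0) * oneᶻ i))
    (cong (_* oneᶻ i) (trans (cong (shiftCoeff l) (ℕP.+-identityʳ n)) (shiftCoeff-top l)))

  Bᶻ-suc : ∀ l k → k ℕ.≤ N → Bᶻ l (suc k) ≗ λ i → mulθᶻ l (Bᶻ l k) i + shiftCoeff l (N ∸ k) * oneᶻ i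
  Bᶻ-suc l k k≤N i = begin
    Bᶻ l (suc k) i
      ≡⟨ ∑-head (suc k) (λ j → shiftCoeff l (N ∸ k ℕ.+ j) * θpowᶻ l j i) ⟩
    shiftCoeff l (N ∸ k ℕ.+ 0) * oneᶻ i + ∑ℤ (suc k) (λ j → shiftCoeff l (N ∸ k ℕ.+ suc j) * θpowᶻ l (suc j) i)
      ≡⟨ cong₂ _+_ (cong (λ z → shiftCoeff l z * oneᶻ i) (ℕP.+-identityʳ (N ∸ k)))
                   (∑-cong (suc k) (λ j _ → cong (λ z → shiftCoeff l z * θpowᶻ l (suc j) i) (index j))) ⟩
    shiftCoeff l (N ∸ k) * oneᶻ i + ∑ℤ (suc k) (λ j → shiftCoeff l (n ∸ k ℕ.+ j) * mulθᶻ l (θpowᶻ l j) i)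
      ≡⟨ cong (λ z → shiftCoeff l (N ∸ k) * oneᶻ i + z) (sym (mulθᶻ-∑ l (suc k) (λ j → shiftCoeff l (n ∸ k ℕ.+ j)) (θpowᶻ l) i)) ⟩
    shiftCoeff l (N ∸ k) * oneᶻ i + mulθᶻ l (Bᶻ l k) i
      ≡⟨ ℤP.+-comm (shiftCoeff l (N ∸ k) * oneᶻ i) (mulθᶻ l (Bᶻ l k) i) ⟩
    mulθᶻ l (Bᶻ l k) i + shiftCoeff l (N ∸ k) * oneᶻ i ∎
    where
    open ≡-Reasoning
    index : ∀ j → N ∸ k ℕ.+ suc j ≡ n ∸ k ℕ.+ j
    index j = trans (ℕP.+-suc (N ∸ k) j) (cong (ℕ._+ j) (sym (ℕP.+-∸-assoc 1 k≤N)))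

  Bᶻ-above : ∀ l k i → k ℕ.< i → Bᶻ l k i ≡ 0ℤ
  Bᶻ-above l k i k<i = ∑-zero (suc k) (λ j j≤k →
    trans (cong (shiftCoeff l (n ∸ k ℕ.+ j) *_) (θpowᶻ-above l j i (ℕP.≤-<-trans (ℕP.≤-pred j≤k) k<i)))
          (ℤP.*-zeroʳ (shiftCoeff l (n ∸ k ℕ.+ j))))

  Bᶻ-diag : ∀ l k → k ℕ.≤ N → Bᶻ l k k ≡ coeff f n
  Bᶻ-diag l zero    _   = trans (Bᶻ-zero l 0) (ℤP.*-identityʳ (coeff f n))
  Bᶻ-diag l (suc k) k<N = begin
    Bᶻ l (suc k) (suc k)                                       ≡⟨ Bᶻ-suc l k k≤N (suc k) ⟩
    Bᶻ l k k + - l * Bᶻ l k (suc k) + shiftCoeff l (N ∸ k) * 0ℤ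
      ≡⟨ cong₂ (λ x y → x + - l * y + shiftCoeff l (N ∸ k) * 0ℤ) (Bᶻ-diag l k k≤N) (Bᶻ-above l k (suc k) ℕP.≤-refl) ⟩
    coeff f n + - l * 0ℤ + shiftCoeff l (N ∸ k) * 0ℤ           ≡⟨ cancel (coeff f n) l (shiftCoeff l (N ∸ k)) ⟩
    coeff f n                                                  ∎
    where
    open ≡-Reasoning
    k≤N = ℕP.<⇒≤ k<N
    cancel : ∀ c l g → c + - l * 0ℤ + g * 0ℤ ≡ c
    cancel = solve-∀

  Bᶻ-subdiag : ∀ l k → k ℕ.< N → Bᶻ l (suc k) k ≡ shiftCoeff l N - + (suc k) * l * coeff f n
  Bᶻ-subdiag l zero    _   = begin
    Bᶻ l 1 0                                 ≡⟨ Bᶻ-suc l 0 z≤n 0 ⟩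
    - l * Bᶻ l 0 0 + shiftCoeff l N * 1ℤ     ≡⟨ cong (λ x → - l * x + shiftCoeff l N * 1ℤ) (Bᶻ-zero l 0) ⟩
    - l * (coeff f n * 1ℤ) + shiftCoeff l N * 1ℤ ≡⟨ lemma (coeff f n) l (shiftCoeff l N) ⟩
    shiftCoeff l N - 1ℤ * l * coeff f n      ∎
    where
    open ≡-Reasoning
    lemma : ∀ c l g → - l * (c * 1ℤ) + g * 1ℤ ≡ g - 1ℤ * l * c
    lemma = solve-∀
  Bᶻ-subdiag l (suc k) k<N = begin
    Bᶻ l (suc (suc k)) (suc k)
      ≡⟨ Bᶻ-suc l (suc k) (ℕP.<⇒≤ k<N) (suc k) ⟩
    Bᶻ l (suc k) k + - l * Bᶻ l (suc k) (suc k) + shiftCoeff l (N ∸ suc k) * 0ℤ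
      ≡⟨ cong₂ (λ x y → x + - l * y + shiftCoeff l (N ∸ suc k) * 0ℤ)
               (Bᶻ-subdiag l k (ℕP.<-trans (ℕP.n<1+n k) k<N)) (Bᶻ-diag l (suc k) (ℕP.<⇒≤ k<N)) ⟩
    shiftCoeff l N - + suc k * l * coeff f n + - l * coeff f n + shiftCoeff l (N ∸ suc k) * 0ℤ
      ≡⟨ cong (λ x → shiftCoeff l N - x * l * coeff f n + - l * coeff f n + shiftCoeff l (N ∸ suc k) * 0ℤ) (ℤP.pos-+ 1 k) ⟩
    shiftCoeff l N - (1ℤ + + k) * l * coeff f n + - l * coeff f n + shiftCoeff l (N ∸ suc k) * 0ℤ
      ≡⟨ lemma (coeff f n) l (shiftCoeff l N) (+ k) (shiftCoeff l (N ∸ suc k)) ⟩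
    shiftCoeff l N - (1ℤ + (1ℤ + + k)) * l * coeff f n
      ≡⟨ cong (λ x → shiftCoeff l N - x * l * coeff f n) (sym (ℤP.pos-+ 2 k)) ⟩
    shiftCoeff l N - + suc (suc k) * l * coeff f n ∎
    where
    open ≡-Reasoning
    lemma : ∀ c l g k h → g - (1ℤ + k) * l * c + - l * c + h * 0ℤ ≡ g - (1ℤ + (1ℤ + k)) * l * c
    lemma = solve-∀

  mulθᶻ-Bᶻ : ∀ l j → j ℕ.≤ N → ∀ i → mulθᶻ l (Bᶻ l j) i ≡ Bᶻ l (suc j) i - shiftCoeff l (N ∸ j) * oneᶻ i
  mulθᶻ-Bᶻ l j j≤N i =
    sym (trans (cong (_- shiftCoeff l (N ∸ j) * oneᶻ i) (Bᶻ-suc l j j≤N i)) (cancel _ _))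
    where cancel : ∀ x y → x + y - y ≡ x
          cancel = solve-∀

  ∑-mulθᶻ-Bᶻ : ∀ l k (w : ℕ → ℤ) → k ℕ.≤ N → ∀ i →
    ∑ℤ (suc k) (λ u → w u * mulθᶻ l (Bᶻ l (k ∸ u)) i)
      ≡ ∑ℤ (suc k) (λ u → w u * Bᶻ l (suc (k ∸ u)) i) - ∑ℤ (suc k) (λ u → w u * shiftCoeff l (N ∸ (k ∸ u))) * oneᶻ i
  ∑-mulθᶻ-Bᶻ l k w k≤N i = begin
    ∑ℤ (suc k) (λ u → w u * mulθᶻ l (Bᶻ l (k ∸ u)) i)
      ≡⟨ ∑-cong (suc k) (λ u _ → trans (cong (w u *_) (mulθᶻ-Bᶻ l (k ∸ u) (ℕP.≤-trans (ℕP.m∸n≤m k u) k≤N) i))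
                                       (distrib (w u) _ _ (oneᶻ i))) ⟩
    ∑ℤ (suc k) (λ u → w u * Bᶻ l (suc (k ∸ u)) i - w u * shiftCoeff l (N ∸ (k ∸ u)) * oneᶻ i)
      ≡⟨ ∑-distrib-- (suc k) _ _ ⟩
    ∑ℤ (suc k) (λ u → w u * Bᶻ l (suc (k ∸ u)) i) - ∑ℤ (suc k) (λ u → w u * shiftCoeff l (N ∸ (k ∸ u)) * oneᶻ i)
      ≡⟨ cong (λ x → ∑ℤ (suc k) (λ u → w u * Bᶻ l (suc (k ∸ u)) i) - x) (∑-*ʳ (suc k) _ (oneᶻ i)) ⟩
    ∑ℤ (suc k) (λ u → w u * Bᶻ l (suc (k ∸ u)) i) - ∑ℤ (suc k) (λ u → w u * shiftCoeff l (N ∸ (k ∸ u))) * oneᶻ i ∎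
    where
    open ≡-Reasoning
    distrib : ∀ w b g e → w * (b - g * e) ≡ w * b - w * g * e
    distrib = solve-∀

  shiftCoeff-+-tail : ∀ a t k → k ℕ.≤ N →
    shiftCoeff (a + t) (N ∸ k)
      ≡ ∑ℤ (suc k) (λ u → β (N ∸ k) u * t ^ u * shiftCoeff a (N ∸ (k ∸ u))) + β (N ∸ k) (suc k) * t ^ suc k * coeff f n
  shiftCoeff-+-tail a t k k≤N = begin
    shiftCoeff (a + t) (N ∸ k)
      ≡⟨ shiftCoeff-+ a t (N ∸ k) ⟩
    ∑ℤ (suc (n ∸ (N ∸ k))) T
      ≡⟨ cong (λ z → ∑ℤ (suc z) T) (trans (ℕP.+-∸-assoc 1 (ℕP.m∸n≤m N k)) (cong suc (ℕP.m∸[m∸n]≡n k≤N))) ⟩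
    ∑ℤ (suc k) T + T (suc k)
      ≡⟨ cong₂ _+_ (∑-cong (suc k) (λ u u≤k → cong (λ p → β (N ∸ k) u * t ^ u * shiftCoeff a p) (m∸n+o≡m∸[n∸o] (ℕP.≤-pred u≤k) k≤N)))
                   (cong (β (N ∸ k) (suc k) * t ^ suc k *_) (trans (cong (shiftCoeff a) top) (shiftCoeff-top a))) ⟩
    ∑ℤ (suc k) (λ u → β (N ∸ k) u * t ^ u * shiftCoeff a (N ∸ (k ∸ u))) + β (N ∸ k) (suc k) * t ^ suc k * coeff f n ∎
    where
    open ≡-Reasoning
    T : ℕ → ℤ
    T r = β (N ∸ k) r * t ^ r * shiftCoeff a (N ∸ k ℕ.+ r)
    top : N ∸ k ℕ.+ suc k ≡ n
    top = trans (ℕP.+-suc (N ∸ k) k) (cong suc (ℕP.m∸n+n≡m k≤N))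

  Bᶻ-shift : ∀ a t k → k ℕ.≤ N →
    Bᶻ (a + t) k ≗ λ i → ∑ℤ (suc k) (λ u → β (N ∸ k) u * t ^ u * Bᶻ a (k ∸ u) i)
  Bᶻ-shift a t zero _ i =
    trans (Bᶻ-zero (a + t) i) (sym (trans (ℤP.+-identityˡ _) (trans (ℤP.*-identityˡ _) (Bᶻ-zero a i))))
  Bᶻ-shift a t (suc k) k<N i = begin
    Bᶻ (a + t) (suc k) i
      ≡⟨ Bᶻ-suc (a + t) k k≤N i ⟩
    mulθᶻ (a + t) (Bᶻ (a + t) k) i + g′ * oneᶻ i
      ≡⟨ cong (_+ g′ * oneᶻ i) (mulθᶻ-+ a t (Bᶻ (a + t) k) i) ⟩
    mulθᶻ a (Bᶻ (a + t) k) i + - t * Bᶻ (a + t) k i + g′ * oneᶻ i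
      ≡⟨ cong₂ (λ x y → x + - t * y + g′ * oneᶻ i) (mulθᶻ-cong a IH i) (IH i) ⟩
    mulθᶻ a (λ j → ∑ℤ (suc k) (λ u → w u * Bᶻ a (k ∸ u) j)) i + - t * S + g′ * oneᶻ i
      ≡⟨ cong (λ x → x + - t * S + g′ * oneᶻ i) (mulθᶻ-∑ a (suc k) w (λ u → Bᶻ a (k ∸ u)) i) ⟩
    ∑ℤ (suc k) (λ u → w u * mulθᶻ a (Bᶻ a (k ∸ u)) i) + - t * S + g′ * oneᶻ i
      ≡⟨ cong₂ (λ x y → x + - t * S + y * oneᶻ i) (∑-mulθᶻ-Bᶻ a k w k≤N i) (shiftCoeff-+-tail a t k k≤N) ⟩
    S₊ - G * oneᶻ i + - t * S + (G + β (N ∸ k) (suc k) * t ^ suc k * coeff f n) * oneᶻ i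
      ≡⟨ collect S₊ G (oneᶻ i) t S (β (N ∸ k) (suc k) * t ^ suc k) (coeff f n) ⟩
    S₊ - t * S + β (N ∸ k) (suc k) * t ^ suc k * (coeff f n * oneᶻ i)
      ≡⟨ cong (λ x → S₊ - t * S + β (N ∸ k) (suc k) * t ^ suc k * x) (sym (Bᶻ-zero a i)) ⟩
    E (N ∸ k)
      ≡⟨ cong E (ℕP.+-∸-assoc 1 k<N) ⟩
    E (suc (N ∸ suc k))
      ≡⟨ pascal-convolution (N ∸ suc k) k t (λ j → Bᶻ a j i) ⟩
    ∑ℤ (suc (suc k)) (λ u → β (N ∸ suc k) u * t ^ u * Bᶻ a (suc k ∸ u) i) ∎
    where
    open ≡-Reasoning
    k≤N = ℕP.<⇒≤ k<N
    IH = Bᶻ-shift a t k k≤N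
    g′ = shiftCoeff (a + t) (N ∸ k)
    w : ℕ → ℤ
    w u = β (N ∸ k) u * t ^ u
    S = ∑ℤ (suc k) (λ u → w u * Bᶻ a (k ∸ u) i)
    S₊ = ∑ℤ (suc k) (λ u → w u * Bᶻ a (suc (k ∸ u)) i)
    G = ∑ℤ (suc k) (λ u → w u * shiftCoeff a (N ∸ (k ∸ u)))
    E : ℕ → ℤ
    E s = ∑ℤ (suc k) (λ u → β s u * t ^ u * Bᶻ a (suc (k ∸ u)) i)
          - t * ∑ℤ (suc k) (λ u → β s u * t ^ u * Bᶻ a (k ∸ u) i)
          + β s (suc k) * t ^ suc k * Bᶻ a 0 i
    collect : ∀ x g e t s b c → x - g * e + - t * s + (g + b * c) * e ≡ x - t * s + b * (c * e)
    collect = solve-∀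

  basisᶻ : ℤ → ℕ → ℕ → ℤ
  basisᶻ l zero    = oneᶻ
  basisᶻ l (suc k) = Bᶻ l (suc k)

  basisᶻ-above : ∀ l k i → k ℕ.< i → basisᶻ l k i ≡ 0ℤ
  basisᶻ-above l zero    (suc i) _   = refl
  basisᶻ-above l (suc k) i       k<i = Bᶻ-above l (suc k) i k<i

  Span : (ℕ → ℕ → ℤ) → (ℕ → ℤ) → Set
  Span G P = Σ (ℕ → ℤ) (λ z → P ≗ λ i → ∑ℤ n (λ k → z k * G k i))

  module _ {G : ℕ → ℕ → ℤ} where

    span-≗ : ∀ {P Q} → P ≗ Q → Span G P → Span G Q
    span-≗ P≗Q (z , P≗) = z , λ i → trans (sym (P≗Q i)) (P≗ i)

    span-+ : ∀ {P Q} → Span G P → Span G Q → Span G (λ i → P i + Q i)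
    span-+ (z , P≗) (z′ , Q≗) = (λ k → z k + z′ k) , λ i →
      trans (cong₂ _+_ (P≗ i) (Q≗ i))
            (trans (sym (∑-distrib-+ n _ _)) (∑-cong n (λ k _ → sym (ℤP.*-distribʳ-+ (G k i) (z k) (z′ k)))))

    span-* : ∀ {P} x → Span G P → Span G (λ i → x * P i)
    span-* x (z , P≗) = (λ k → x * z k) , λ i →
      trans (cong (x *_) (P≗ i)) (trans (sym (∑-*ˡ n x _)) (∑-cong n (λ k _ → sym (ℤP.*-assoc x (z k) (G k i)))))

    span-∑ : ∀ K (F : ℕ → ℕ → ℤ) → (∀ u → u ℕ.< K → Span G (F u)) → Span G (λ i → ∑ℤ K (λ u → F u i))
    span-∑ zero    F F∈ = (λ _ → 0ℤ) , λ i → sym (∑-zero n (λ k _ → ℤP.*-zeroˡ (G k i)))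
    span-∑ (suc K) F F∈ = span-+ (span-∑ K F (λ u u<K → F∈ u (ℕP.m<n⇒m<1+n u<K))) (F∈ K ℕP.≤-refl)

    span-mono : ∀ {H P} → (∀ k → k ℕ.< n → Span G (H k)) → Span H P → Span G P
    span-mono {H} H⊆G (z , P≗) =
      span-≗ (λ i → sym (P≗ i)) (span-∑ n (λ k i → z k * H k i) (λ k k<n → span-* (z k) (H⊆G k k<n)))

    span-gen : ∀ k → k ℕ.< n → Span G (G k)
    span-gen k k<n = indicator , λ i → sym (trans (∑-single n k _ k<n (λ j j≢k → off j j≢k (G j i))) (on (G k i)))
      where
      indicator : ℕ → ℤ
      indicator j with j ℕP.≟ k
      ... | yes _ = 1ℤ
      ... | no  _ = 0ℤ
      off : ∀ j → j ≢ k → ∀ x → indicator j * x ≡ 0ℤ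
      off j j≢k x with j ℕP.≟ k
      ... | yes j≡k = ⊥-elim (j≢k j≡k)
      ... | no  _   = refl
      on : ∀ x → indicator k * x ≡ x
      on x with k ℕP.≟ k
      ... | yes _   = ℤP.*-identityˡ x
      ... | no  k≢k = ⊥-elim (k≢k refl)

module Generators {N′ : ℕ} (f : BinForm (suc (suc N′))) (m : ℕ) where

  open Polynomials f

  N : ℕ
  N = suc N′

  -- m times the generators of R′: m · basisᶻ l k for k < N, and basisᶻ l N itself.
  genᶻ : ℤ → ℕ → ℕ → ℤ
  genᶻ l k i with suc k ℕ.≟ n
  ... | yes _ = basisᶻ l k i
  ... | no  _ = + m * basisᶻ l k i

  genᶻ-top : ∀ l → genᶻ l N ≗ Bᶻ l N
  genᶻ-top l i with suc N ℕ.≟ n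
  ... | yes _     = refl
  ... | no  1+N≢n = ⊥-elim (1+N≢n refl)

  genᶻ-low : ∀ l k → k ℕ.< N → genᶻ l k ≗ λ i → + m * basisᶻ l k i
  genᶻ-low l k k<N i with suc k ℕ.≟ n
  ... | yes 1+k≡n = ⊥-elim (ℕP.<-irrefl (ℕP.suc-injective 1+k≡n) k<N)
  ... | no  _     = refl

  genᶻ-above : ∀ l k i → k ℕ.< i → genᶻ l k i ≡ 0ℤ
  genᶻ-above l k i k<i with suc k ℕ.≟ n
  ... | yes _ = basisᶻ-above l k i k<i
  ... | no  _ = trans (cong (+ m *_) (basisᶻ-above l k i k<i)) (ℤP.*-zeroʳ (+ m))

  mBᶻ∈span : ∀ a j → j ℕ.< N → Span (genᶻ a) (λ i → + m * Bᶻ a j i)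
  mBᶻ∈span a zero    0<N = span-≗ eq (span-* (coeff f n) (span-gen 0 (s≤s z≤n)))
    where
    eq : ∀ i → coeff f n * genᶻ a 0 i ≡ + m * Bᶻ a 0 i
    eq i rewrite genᶻ-low a 0 0<N i | Bᶻ-zero a i = swap (coeff f n) (+ m) (oneᶻ i)
      where swap : ∀ c m e → c * (m * e) ≡ m * (c * e)
            swap = solve-∀
  mBᶻ∈span a (suc j) j<N = span-≗ (genᶻ-low a (suc j) j<N) (span-gen (suc j) (ℕP.m<n⇒m<1+n j<N))

  shift-mBᶻ∈span : ∀ a t k → k ℕ.< N → Span (genᶻ a) (λ i → + m * Bᶻ (a + t) k i)
  shift-mBᶻ∈span a t k k<N =
    span-≗ eq (span-∑ (suc k) F (λ u _ → span-* (β (N ∸ k) u * t ^ u)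
                                    (mBᶻ∈span a (k ∸ u) (ℕP.≤-<-trans (ℕP.m∸n≤m k u) k<N))))
    where
    F : ℕ → ℕ → ℤ
    F u i = β (N ∸ k) u * t ^ u * (+ m * Bᶻ a (k ∸ u) i)
    eq : ∀ i → ∑ℤ (suc k) (λ u → F u i) ≡ + m * Bᶻ (a + t) k i
    eq i = trans (∑-cong (suc k) (λ u _ → swap (β (N ∸ k) u * t ^ u) (+ m) (Bᶻ a (k ∸ u) i)))
                 (trans (∑-*ˡ (suc k) (+ m) _) (cong (+ m *_) (sym (Bᶻ-shift a t k (ℕP.<⇒≤ k<N) i))))
      where swap : ∀ w m x → w * (m * x) ≡ m * (w * x)
            swap = solve-∀

  -- Every term of the shift formula but the first carries a factor t, hence a factor m.
  shift-Bᶻ-top∈span : ∀ a t q → t ≡ q * + m → Span (genᶻ a) (Bᶻ (a + t) N)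
  shift-Bᶻ-top∈span a .(q * + m) q refl =
    span-≗ eq (span-+ (span-≗ (genᶻ-top a) (span-gen N ℕP.≤-refl))
                      (span-∑ N F (λ u _ → span-* (β 0 (suc u) * t ^ u * q)
                                             (mBᶻ∈span a (N ∸ suc u) (s≤s (ℕP.m∸n≤m N′ u))))))
    where
    t = q * + m
    F : ℕ → ℕ → ℤ
    F u i = β 0 (suc u) * t ^ u * q * (+ m * Bᶻ a (N ∸ suc u) i)
    eq : ∀ i → Bᶻ a N i + ∑ℤ N (λ u → F u i) ≡ Bᶻ (a + t) N i
    eq i = sym (begin
      Bᶻ (a + t) N i
        ≡⟨ Bᶻ-shift a t N ℕP.≤-refl i ⟩
      ∑ℤ (suc N) (λ u → β (N ∸ N) u * t ^ u * Bᶻ a (N ∸ u) i)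
        ≡⟨ cong (λ s → ∑ℤ (suc N) (λ u → β s u * t ^ u * Bᶻ a (N ∸ u) i)) (ℕP.n∸n≡0 N) ⟩
      ∑ℤ (suc N) (λ u → β 0 u * t ^ u * Bᶻ a (N ∸ u) i)
        ≡⟨ ∑-head N (λ u → β 0 u * t ^ u * Bᶻ a (N ∸ u) i) ⟩
      1ℤ * 1ℤ * Bᶻ a N i + ∑ℤ N (λ u → β 0 (suc u) * t ^ suc u * Bᶻ a (N ∸ suc u) i)
        ≡⟨ cong₂ _+_ (ℤP.*-identityˡ (Bᶻ a N i)) (∑-cong N (λ u _ → factor (β 0 (suc u)) q (+ m) (t ^ u) (Bᶻ a (N ∸ suc u) i))) ⟩
      Bᶻ a N i + ∑ℤ N (λ u → F u i) ∎)
      where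
      open ≡-Reasoning
      factor : ∀ b q m T x → b * (q * m * T) * x ≡ b * T * q * (m * x)
      factor = solve-∀


  genᶻ-shift∈span : ∀ a t q → t ≡ q * + m → ∀ k → k ℕ.< n → Span (genᶻ a) (genᶻ (a + t) k)
  genᶻ-shift∈span a t q t≡qm k k<n with ℕP.m≤n⇒m<n∨m≡n (ℕP.≤-pred k<n)
  ... | inj₂ refl = span-≗ (λ i → sym (genᶻ-top (a + t) i)) (shift-Bᶻ-top∈span a t q t≡qm)
  ... | inj₁ k<N  = below k k<N
    where
    below : ∀ k → k ℕ.< N → Span (genᶻ a) (genᶻ (a + t) k)
    below zero    0<N = span-≗ (λ i → trans (genᶻ-low a 0 0<N i) (sym (genᶻ-low (a + t) 0 0<N i))) (span-gen 0 (s≤s z≤n))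
    below (suc k) k<N = span-≗ (λ i → sym (genᶻ-low (a + t) (suc k) k<N i)) (shift-mBᶻ∈span a t (suc k) k<N)

  span-shift : ∀ a t q → t ≡ q * + m → ∀ {P} → Span (genᶻ (a + t)) P → Span (genᶻ a) P
  span-shift a t q t≡qm = span-mono (genᶻ-shift∈span a t q t≡qm)

  genᶻ-below : ∀ a (z : ℕ → ℤ) i → ∑ℤ i (λ k → z k * genᶻ a k i) ≡ 0ℤ
  genᶻ-below a z i = ∑-zero i (λ k k<i → trans (cong (z k *_) (genᶻ-above a k i k<i)) (ℤP.*-zeroʳ (z k)))

  genᶻ-top-diag : ∀ l → genᶻ l N N ≡ coeff f n
  genᶻ-top-diag l = trans (genᶻ-top l N) (Bᶻ-diag l N ℕP.≤-refl)

  genᶻ-top-subdiag : ∀ l → genᶻ l N N′ ≡ coeff f N + l * coeff f n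
  genᶻ-top-subdiag l = begin
    genᶻ l N N′                                                   ≡⟨ genᶻ-top l N′ ⟩
    Bᶻ l N N′                                                     ≡⟨ Bᶻ-subdiag l N′ ℕP.≤-refl ⟩
    shiftCoeff l N - + N * l * coeff f n                          ≡⟨ cong (_- + N * l * coeff f n) (shiftCoeff-subtop l) ⟩
    coeff f N + (1ℤ + + N) * l * coeff f n - + N * l * coeff f n  ≡⟨ simplify (coeff f N) (+ N) l (coeff f n) ⟩
    coeff f N + l * coeff f n                                     ∎
    where
    open ≡-Reasoning
    simplify : ∀ x M l c → x + (1ℤ + M) * l * c - M * l * c ≡ x + l * c
    simplify = solve-∀

  genᶻ-subtop-diag : 1 ℕ.≤ N′ → ∀ l → genᶻ l N′ N′ ≡ + m * coeff f n
  genᶻ-subtop-diag 1≤N′ l = trans (genᶻ-low l N′ ℕP.≤-refl N′) (cong (+ m *_) (basisᶻ-diag N′ 1≤N′ (ℕP.n≤1+n N′)))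
    where basisᶻ-diag : ∀ k → 1 ℕ.≤ k → k ℕ.≤ N → basisᶻ l k k ≡ coeff f n
          basisᶻ-diag (suc k) _ k<N = Bᶻ-diag l (suc k) k<N

  -- Compare the coefficients of δ^N and δ^N′ on both sides.
  top-generator⇒∣ : 1 ℕ.≤ N′ → coeff f n ≢ 0ℤ → ∀ a b (z : ℕ → ℤ) →
    (∀ i → i ℕ.< n → genᶻ b N i ≡ ∑ℤ n (λ k → z k * genᶻ a k i)) → + m ∣ (a - b)
  top-generator⇒∣ 1≤N′ c≢0 a b z b≡ = Sg.∣⇒∣ᵤ (Sg.divides (- z N′) a-b≡)
    where
    open ≡-Reasoning
    c = coeff f n
    instance
      c-nonZero : ℤ.NonZero c
      c-nonZero = ℤ.≢-nonZero c≢0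
    at-N : c ≡ 0ℤ + z N * c
    at-N = begin
      c                                                ≡⟨ sym (genᶻ-top-diag b) ⟩
      genᶻ b N N                                       ≡⟨ b≡ N ℕP.≤-refl ⟩
      ∑ℤ N (λ k → z k * genᶻ a k N) + z N * genᶻ a N N ≡⟨ cong₂ (λ x y → x + z N * y) (genᶻ-below a z N) (genᶻ-top-diag a) ⟩
      0ℤ + z N * c                                     ∎
    at-N′ : coeff f N + b * c ≡ 0ℤ + z N′ * (+ m * c) + z N * (coeff f N + a * c)
    at-N′ = begin
      coeff f N + b * c                                ≡⟨ sym (genᶻ-top-subdiag b) ⟩
      genᶻ b N N′                                      ≡⟨ b≡ N′ (ℕP.≤-trans (ℕP.n≤1+n N) ℕP.≤-refl) ⟩
      ∑ℤ N′ (λ k → z k * genᶻ a k N′) + z N′ * genᶻ a N′ N′ + z N * genᶻ a N N′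
        ≡⟨ cong₂ _+_ (cong₂ (λ x y → x + z N′ * y) (genᶻ-below a z N′) (genᶻ-subtop-diag 1≤N′ a))
                     (cong (z N *_) (genᶻ-top-subdiag a)) ⟩
      0ℤ + z N′ * (+ m * c) + z N * (coeff f N + a * c) ∎
    zN≡1 : z N ≡ 1ℤ
    zN≡1 = sym (ℤP.*-cancelʳ-≡ 1ℤ (z N) c (trans (ℤP.*-identityˡ c) (trans at-N (ℤP.+-identityˡ (z N * c)))))
    [b-a]c≡zmc : ∀ z₁ z₂ → z₂ ≡ 1ℤ → coeff f N + b * c ≡ 0ℤ + z₁ * (+ m * c) + z₂ * (coeff f N + a * c) →
      (b - a) * c ≡ z₁ * + m * c
    [b-a]c≡zmc z₁ .1ℤ refl eq =
      trans (expand (coeff f N) a b c) (trans (cong (_- (coeff f N + a * c)) eq) (collapse (coeff f N) a c z₁ (+ m)))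
      where
      expand : ∀ x a b c → (b - a) * c ≡ x + b * c - (x + a * c)
      expand = solve-∀
      collapse : ∀ x a c z m → 0ℤ + z * (m * c) + 1ℤ * (x + a * c) - (x + a * c) ≡ z * m * c
      collapse = solve-∀
    a-b≡ : a - b ≡ - z N′ * + m
    a-b≡ = begin
      a - b          ≡⟨ flip a b ⟩
      - (b - a)      ≡⟨ cong -_ (ℤP.*-cancelʳ-≡ (b - a) (z N′ * + m) c ([b-a]c≡zmc (z N′) (z N) zN≡1 at-N′)) ⟩
      - (z N′ * + m) ≡⟨ ℤP.neg-distribˡ-* (z N′) (+ m) ⟩
      - z N′ * + m   ∎
      where flip : ∀ a b → a - b ≡ - (b - a)
            flip = solve-∀

fromℤ-mkℚ : ∀ x → fromℤ x ≡ mkℚ x 0 (Cop.sym (Cop.1-coprimeTo _))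
fromℤ-mkℚ x = ℚP.↥p/↧p≡p (mkℚ x 0 (Cop.sym (Cop.1-coprimeTo _)))

fromℤ-+ : ∀ x y → fromℤ (x + y) ≡ fromℤ x ℚ.+ fromℤ y
fromℤ-+ x y = sym (trans (cong₂ ℚ._+_ (fromℤ-mkℚ x) (fromℤ-mkℚ y))
                         (cong (ℚ._/ 1) (cong₂ _+_ (ℤP.*-identityʳ x) (ℤP.*-identityʳ y))))

fromℤ-* : ∀ x y → fromℤ (x * y) ≡ fromℤ x ℚ.* fromℤ y
fromℤ-* x y = sym (cong₂ ℚ._*_ (fromℤ-mkℚ x) (fromℤ-mkℚ y))

fromℤ-injective : ∀ {x y} → fromℤ x ≡ fromℤ y → x ≡ y
fromℤ-injective {x} {y} eq = cong ℚ.↥_ (trans (sym (fromℤ-mkℚ x)) (trans eq (fromℤ-mkℚ y)))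

recipℕ-inverseˡ : ∀ k → recipℕ (suc k) ℚ.* fromℤ (+ suc k) ≡ ℚ.1ℚ
recipℕ-inverseˡ k =
  trans (cong₂ ℚ._*_ (ℚP.↥p/↧p≡p (mkℚ (+ 1) k (Cop.1-coprimeTo _))) (fromℤ-mkℚ (+ suc k)))
        (ℚP.*-inverseˡ (mkℚ (+ suc k) 0 (Cop.sym (Cop.1-coprimeTo _))))

recipℕ-cancel : ∀ k x → recipℕ (suc k) ℚ.* fromℤ (+ suc k * x) ≡ fromℤ x
recipℕ-cancel k x = begin
  recipℕ (suc k) ℚ.* fromℤ (+ suc k * x)               ≡⟨ cong (recipℕ (suc k) ℚ.*_) (fromℤ-* (+ suc k) x) ⟩
  recipℕ (suc k) ℚ.* (fromℤ (+ suc k) ℚ.* fromℤ x)     ≡⟨ sym (ℚP.*-assoc (recipℕ (suc k)) (fromℤ (+ suc k)) (fromℤ x)) ⟩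
  recipℕ (suc k) ℚ.* fromℤ (+ suc k) ℚ.* fromℤ x       ≡⟨ cong (ℚ._* fromℤ x) (recipℕ-inverseˡ k) ⟩
  ℚ.1ℚ ℚ.* fromℤ x                                     ≡⟨ ℚP.*-identityˡ (fromℤ x) ⟩
  fromℤ x                                              ∎
  where open ≡-Reasoning

recipℕ-*-injective : ∀ k {x y} → recipℕ (suc k) ℚ.* fromℤ x ≡ recipℕ (suc k) ℚ.* fromℤ y → x ≡ y
recipℕ-*-injective k {x} {y} eq = fromℤ-injective (trans (sym (undo x)) (trans (cong (fromℤ (+ suc k) ℚ.*_) eq) (undo y)))
  where
  undo : ∀ x → fromℤ (+ suc k) ℚ.* (recipℕ (suc k) ℚ.* fromℤ x) ≡ fromℤ x
  undo x = trans (sym (ℚP.*-assoc (fromℤ (+ suc k)) (recipℕ (suc k)) (fromℤ x)))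
                 (trans (cong (ℚ._* fromℤ x) (trans (ℚP.*-comm (fromℤ (+ suc k)) (recipℕ (suc k))) (recipℕ-inverseˡ k)))
                        (ℚP.*-identityˡ (fromℤ x)))

lookup-ext : ∀ {A : Set} {k} (u v : Vec A k) → (∀ i → lookup u i ≡ lookup v i) → u ≡ v
lookup-ext u v u≗v = trans (sym (VP.tabulate∘lookup u)) (trans (VP.tabulate-cong u≗v) (VP.tabulate∘lookup v))

lookup-init : ∀ {A : Set} {k} (v : Vec A (suc k)) (i : Fin k) → lookup (init v) i ≡ lookup v (inject₁ i)
lookup-init {k = suc k} (x ∷ xs) Fin.zero    = refl
lookup-init {k = suc k} (x ∷ xs) (Fin.suc i) = lookup-init xs i

lookup-last : ∀ {A : Set} {k} (v : Vec A (suc k)) → last v ≡ lookup v (fromℕ k)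
lookup-last {k = zero}  (x ∷ []) = refl
lookup-last {k = suc k} (x ∷ xs) = lookup-last xs

lookup-⊕ : ∀ {k} (u v : K k) i → lookup (u ⊕ v) i ≡ lookup u i ℚ.+ lookup v i
lookup-⊕ u v i = VP.lookup-zipWith ℚ._+_ i u v

lookup-⊙ : ∀ {k} q (v : K k) i → lookup (q ⊙ v) i ≡ q ℚ.* lookup v i
lookup-⊙ q v i = VP.lookup-map i (q ℚ.*_) v

lookup-∑K : ∀ {k} M (F : ℕ → K k) (G : ℕ → ℤ) r i →
  (∀ j → j ℕ.< M → lookup (F j) i ≡ r ℚ.* fromℤ (G j)) → lookup (∑K M F) i ≡ r ℚ.* fromℤ (∑ℤ M G)
lookup-∑K zero    F G r i F≡ = trans (VP.lookup-replicate i ℚ.0ℚ) (sym (ℚP.*-zeroʳ r))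
lookup-∑K (suc M) F G r i F≡ = begin
  lookup (∑K M F ⊕ F M) i                          ≡⟨ lookup-⊕ (∑K M F) (F M) i ⟩
  lookup (∑K M F) i ℚ.+ lookup (F M) i             ≡⟨ cong₂ ℚ._+_ (lookup-∑K M F G r i (λ j j<M → F≡ j (ℕP.m<n⇒m<1+n j<M)))
                                                                  (F≡ M ℕP.≤-refl) ⟩
  r ℚ.* fromℤ (∑ℤ M G) ℚ.+ r ℚ.* fromℤ (G M)       ≡⟨ sym (ℚP.*-distribˡ-+ r (fromℤ (∑ℤ M G)) (fromℤ (G M))) ⟩
  r ℚ.* (fromℤ (∑ℤ M G) ℚ.+ fromℤ (G M))           ≡⟨ cong (r ℚ.*_) (sym (fromℤ-+ (∑ℤ M G) (G M))) ⟩
  r ℚ.* fromℤ (∑ℤ M G + G M)                       ∎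
  where open ≡-Reasoning

coeff-tabulate : ∀ {k} (h : Fin k → ℤ) (H : ℕ → ℤ) → (∀ j → h j ≡ H (toℕ j)) → (∀ p → k ℕ.≤ p → H p ≡ 0ℤ) →
  ∀ p → coeff (tabulate h) p ≡ H p
coeff-tabulate {zero}  h H h≡H H≡0 p       = sym (H≡0 p z≤n)
coeff-tabulate {suc k} h H h≡H H≡0 zero    = h≡H Fin.zero
coeff-tabulate {suc k} h H h≡H H≡0 (suc p) =
  coeff-tabulate (h ∘ Fin.suc) (H ∘ suc) (h≡H ∘ Fin.suc) (λ p k≤p → H≡0 (suc p) (s≤s k≤p)) p

module Coordinates {N : ℕ} (f : BinForm (suc N)) where

  open Polynomials f

  infix 4 _≅ᶻ_
  _≅ᶻ_ : K n → (ℕ → ℤ) → Set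
  v ≅ᶻ P = ∀ i → lookup v i ≡ fromℤ (P (toℕ i))

  oneK≅oneᶻ : oneK ≅ᶻ oneᶻ
  oneK≅oneᶻ Fin.zero    = refl
  oneK≅oneᶻ (Fin.suc i) = VP.lookup-replicate i ℚ.0ℚ

  mulδ-shift : ∀ v → last v ≡ ℚ.0ℚ → ∀ i → lookup (mulδ f v) i ≡ lookup (ℚ.0ℚ ∷ init v) i
  mulδ-shift v last≡0 i = begin
    lookup (mulδ f v) i                                       ≡⟨ lookup-⊕ (ℚ.0ℚ ∷ init v) ((ℚ.- r) ⊙ T) i ⟩
    lookup (ℚ.0ℚ ∷ init v) i ℚ.+ lookup ((ℚ.- r) ⊙ T) i        ≡⟨ cong (lookup (ℚ.0ℚ ∷ init v) i ℚ.+_) (lookup-⊙ (ℚ.- r) T i) ⟩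
    lookup (ℚ.0ℚ ∷ init v) i ℚ.+ ℚ.- r ℚ.* lookup T i        ≡⟨ cong (λ x → lookup (ℚ.0ℚ ∷ init v) i ℚ.+ ℚ.- (x ℚ.* c⁻¹) ℚ.* lookup T i) last≡0 ⟩
    lookup (ℚ.0ℚ ∷ init v) i ℚ.+ ℚ.- (ℚ.0ℚ ℚ.* c⁻¹) ℚ.* lookup T i
                                                              ≡⟨ cong (λ x → lookup (ℚ.0ℚ ∷ init v) i ℚ.+ ℚ.- x ℚ.* lookup T i) (ℚP.*-zeroˡ c⁻¹) ⟩
    lookup (ℚ.0ℚ ∷ init v) i ℚ.+ ℚ.0ℚ ℚ.* lookup T i         ≡⟨ cong (lookup (ℚ.0ℚ ∷ init v) i ℚ.+_) (ℚP.*-zeroˡ (lookup T i)) ⟩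
    lookup (ℚ.0ℚ ∷ init v) i ℚ.+ ℚ.0ℚ                        ≡⟨ ℚP.+-identityʳ (lookup (ℚ.0ℚ ∷ init v) i) ⟩
    lookup (ℚ.0ℚ ∷ init v) i                                  ∎
    where
    open ≡-Reasoning
    T = tabulate (λ (i : Fin n) → fromℤ (coeff f (toℕ i)))
    c⁻¹ = recipℤ (coeff f n)
    r = last v ℚ.* c⁻¹

  mulθ-≅ᶻ : ∀ l v {P} → v ≅ᶻ P → P N ≡ 0ℤ → mulθ f l v ≅ᶻ mulθᶻ l P
  mulθ-≅ᶻ l v {P} v≅P P[N]≡0 i = begin
    lookup (mulθ f l v) i
      ≡⟨ lookup-⊕ (mulδ f v) (fromℤ (- l) ⊙ v) i ⟩
    lookup (mulδ f v) i ℚ.+ lookup (fromℤ (- l) ⊙ v) i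
      ≡⟨ cong₂ ℚ._+_ (mulδ-shift v last≡0 i) (trans (lookup-⊙ (fromℤ (- l)) v i) (cong (fromℤ (- l) ℚ.*_) (v≅P i))) ⟩
    lookup (ℚ.0ℚ ∷ init v) i ℚ.+ fromℤ (- l) ℚ.* fromℤ (P (toℕ i))
      ≡⟨ shifted i ⟩
    fromℤ (mulθᶻ l P (toℕ i)) ∎
    where
    open ≡-Reasoning
    last≡0 : last v ≡ ℚ.0ℚ
    last≡0 = trans (lookup-last v) (trans (v≅P (fromℕ N)) (trans (cong (fromℤ ∘ P) (FP.toℕ-fromℕ N)) (cong fromℤ P[N]≡0)))
    shifted : ∀ i → lookup (ℚ.0ℚ ∷ init v) i ℚ.+ fromℤ (- l) ℚ.* fromℤ (P (toℕ i)) ≡ fromℤ (mulθᶻ l P (toℕ i))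
    shifted Fin.zero    = trans (ℚP.+-identityˡ (fromℤ (- l) ℚ.* fromℤ (P 0))) (sym (fromℤ-* (- l) (P 0)))
    shifted (Fin.suc i) = begin
      lookup (init v) i ℚ.+ fromℤ (- l) ℚ.* fromℤ (P (suc (toℕ i)))
        ≡⟨ cong (ℚ._+ fromℤ (- l) ℚ.* fromℤ (P (suc (toℕ i))))
                (trans (lookup-init v i) (trans (v≅P (inject₁ i)) (cong (fromℤ ∘ P) (FP.toℕ-inject₁ i)))) ⟩
      fromℤ (P (toℕ i)) ℚ.+ fromℤ (- l) ℚ.* fromℤ (P (suc (toℕ i)))
        ≡⟨ cong (fromℤ (P (toℕ i)) ℚ.+_) (sym (fromℤ-* (- l) (P (suc (toℕ i))))) ⟩
      fromℤ (P (toℕ i)) ℚ.+ fromℤ (- l * P (suc (toℕ i)))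
        ≡⟨ sym (fromℤ-+ (P (toℕ i)) (- l * P (suc (toℕ i)))) ⟩
      fromℤ (P (toℕ i) + - l * P (suc (toℕ i))) ∎

  θpow-≅ᶻ : ∀ l j → j ℕ.< n → θpow f l j ≅ᶻ θpowᶻ l j
  θpow-≅ᶻ l zero    _         = oneK≅oneᶻ
  θpow-≅ᶻ l (suc j) (s≤s j<N) = mulθ-≅ᶻ l (θpow f l j) (θpow-≅ᶻ l j (ℕP.m<n⇒m<1+n j<N)) (θpowᶻ-above l j N j<N)

  coeff-shiftForm : ∀ l p → coeff (shiftForm l f) p ≡ shiftCoeff l p
  coeff-shiftForm l = coeff-tabulate (λ j → shiftCoeff l (toℕ j)) (shiftCoeff l) (λ j → refl) (shiftCoeff-above l)

  basisB-≅ᶻ : ∀ l k → k ℕ.< n → basisB f l k ≅ᶻ basisᶻ l k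
  basisB-≅ᶻ l zero    _     = oneK≅oneᶻ
  basisB-≅ᶻ l (suc k) k<N i =
    trans (lookup-∑K (suc (suc k)) F (λ j → shiftCoeff l (n ∸ suc k ℕ.+ j) * θpowᶻ l j (toℕ i)) ℚ.1ℚ i term)
          (ℚP.*-identityˡ (fromℤ (Bᶻ l (suc k) (toℕ i))))
    where
    F : ℕ → K n
    F j = fromℤ (coeff (shiftForm l f) (n ∸ suc k ℕ.+ j)) ⊙ θpow f l j
    term : ∀ j → j ℕ.< suc (suc k) → lookup (F j) i ≡ ℚ.1ℚ ℚ.* fromℤ (shiftCoeff l (n ∸ suc k ℕ.+ j) * θpowᶻ l j (toℕ i))
    term j j<2+k = begin
      lookup (F j) i
        ≡⟨ lookup-⊙ (fromℤ (coeff (shiftForm l f) (n ∸ suc k ℕ.+ j))) (θpow f l j) i ⟩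
      fromℤ (coeff (shiftForm l f) (n ∸ suc k ℕ.+ j)) ℚ.* lookup (θpow f l j) i
        ≡⟨ cong₂ ℚ._*_ (cong fromℤ (coeff-shiftForm l (n ∸ suc k ℕ.+ j))) (θpow-≅ᶻ l j (ℕP.<-≤-trans j<2+k k<N) i) ⟩
      fromℤ (shiftCoeff l (n ∸ suc k ℕ.+ j)) ℚ.* fromℤ (θpowᶻ l j (toℕ i))
        ≡⟨ sym (fromℤ-* (shiftCoeff l (n ∸ suc k ℕ.+ j)) (θpowᶻ l j (toℕ i))) ⟩
      fromℤ (shiftCoeff l (n ∸ suc k ℕ.+ j) * θpowᶻ l j (toℕ i))
        ≡⟨ sym (ℚP.*-identityˡ (fromℤ (shiftCoeff l (n ∸ suc k ℕ.+ j) * θpowᶻ l j (toℕ i)))) ⟩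
      ℚ.1ℚ ℚ.* fromℤ (shiftCoeff l (n ∸ suc k ℕ.+ j) * θpowᶻ l j (toℕ i)) ∎
      where open ≡-Reasoning

module Membership {N′ : ℕ} (f : BinForm (suc (suc N′))) (m′ : ℕ) where

  m : ℕ
  m = suc m′

  open Polynomials f
  open Coordinates f
  open Generators f m

  infix 4 _≅ᶻ_/m
  _≅ᶻ_/m : K n → (ℕ → ℤ) → Set
  x ≅ᶻ P /m = ∀ i → lookup x i ≡ recipℕ m ℚ.* fromℤ (P (toℕ i))

  genR′-≅ᶻ : ∀ l k → k ℕ.< n → genR' f l m k ≅ᶻ genᶻ l k /m
  genR′-≅ᶻ l k k<n i with suc k ℕ.≟ n
  ... | yes _ = trans (lookup-⊙ (recipℕ m) (basisB f l k) i) (cong (recipℕ m ℚ.*_) (basisB-≅ᶻ l k k<n i))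
  ... | no  _ = trans (basisB-≅ᶻ l k k<n i) (sym (recipℕ-cancel m′ (basisᶻ l k (toℕ i))))

  private
    combination-≅ᶻ : ∀ l (z : ℕ → ℤ) → ∑K n (λ k → fromℤ (z k) ⊙ genR' f l m k) ≅ᶻ (λ i → ∑ℤ n (λ k → z k * genᶻ l k i)) /m
    combination-≅ᶻ l z i = lookup-∑K n (λ k → fromℤ (z k) ⊙ genR' f l m k) (λ k → z k * genᶻ l k (toℕ i)) (recipℕ m) i term
      where
      term : ∀ k → k ℕ.< n → lookup (fromℤ (z k) ⊙ genR' f l m k) i ≡ recipℕ m ℚ.* fromℤ (z k * genᶻ l k (toℕ i))
      term k k<n = begin
        lookup (fromℤ (z k) ⊙ genR' f l m k) i                   ≡⟨ lookup-⊙ (fromℤ (z k)) (genR' f l m k) i ⟩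
        fromℤ (z k) ℚ.* lookup (genR' f l m k) i                 ≡⟨ cong (fromℤ (z k) ℚ.*_) (genR′-≅ᶻ l k k<n i) ⟩
        fromℤ (z k) ℚ.* (recipℕ m ℚ.* fromℤ (genᶻ l k (toℕ i)))  ≡⟨ swap (fromℤ (z k)) (recipℕ m) (fromℤ (genᶻ l k (toℕ i))) ⟩
        recipℕ m ℚ.* (fromℤ (z k) ℚ.* fromℤ (genᶻ l k (toℕ i)))  ≡⟨ cong (recipℕ m ℚ.*_) (sym (fromℤ-* (z k) (genᶻ l k (toℕ i)))) ⟩
        recipℕ m ℚ.* fromℤ (z k * genᶻ l k (toℕ i))              ∎
        where
        open ≡-Reasoning
        swap : ∀ x y w → x ℚ.* (y ℚ.* w) ≡ y ℚ.* (x ℚ.* w)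
        swap x y w = trans (sym (ℚP.*-assoc x y w)) (trans (cong (ℚ._* w) (ℚP.*-comm x y)) (ℚP.*-assoc y x w))

  R′⇒span : ∀ l {x} → R' f l m x → Σ (ℕ → ℤ) (λ P → x ≅ᶻ P /m × Span (genᶻ l) P)
  R′⇒span l (z , refl) = _ , combination-≅ᶻ l z , z , (λ _ → refl)

  span⇒R′ : ∀ l x {P} → x ≅ᶻ P /m → Span (genᶻ l) P → R' f l m x
  span⇒R′ l x x≅P (z , P≗) = z , lookup-ext x (∑K n (λ k → fromℤ (z k) ⊙ genR' f l m k)) λ i →
    trans (x≅P i) (trans (cong (λ w → recipℕ m ℚ.* fromℤ w) (P≗ (toℕ i))) (sym (combination-≅ᶻ l z i)))

  R′-shift : ∀ a b → + m ∣ (a - b) → ∀ {x} → R' f a m x → R' f b m x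
  R′-shift a b m∣a-b {x} x∈R′a = shift (Sg.∣ᵤ⇒∣ m∣a-b) (R′⇒span a x∈R′a)
    where
    shift : Sg._∣_ (+ m) (a - b) → Σ (ℕ → ℤ) (λ P → x ≅ᶻ P /m × Span (genᶻ a) P) → R' f b m x
    shift (Sg.divides q a-b≡qm) (P , x≅P , P∈span) =
      span⇒R′ b x x≅P (span-shift b (a - b) q a-b≡qm (subst (λ l → Span (genᶻ l) P) (sym (b+[a-b]≡a a b)) P∈span))
      where b+[a-b]≡a : ∀ a b → b + (a - b) ≡ a
            b+[a-b]≡a = solve-∀

  R′⊆⇒∣ : 1 ℕ.≤ N′ → coeff f n ≢ 0ℤ → ∀ a b → (∀ {x} → R' f b m x → R' f a m x) → + m ∣ (a - b)
  R′⊆⇒∣ 1≤N′ c≢0 a b R′b⊆R′a = recover (R′⇒span a (R′b⊆R′a (span⇒R′ b (genR' f b m N) (genR′-≅ᶻ b N ℕP.≤-refl) (span-gen N ℕP.≤-refl))))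
    where
    recover : Σ (ℕ → ℤ) (λ P → genR' f b m N ≅ᶻ P /m × Span (genᶻ a) P) → + m ∣ (a - b)
    recover (P , top≅P , z , P≗) = top-generator⇒∣ 1≤N′ c≢0 a b z λ i i<n →
      let j = Fin.fromℕ< i<n in
      subst (λ i → genᶻ b N i ≡ ∑ℤ n (λ k → z k * genᶻ a k i)) (FP.toℕ-fromℕ< i<n)
            (trans (recipℕ-*-injective m′ (trans (sym (genR′-≅ᶻ b N ℕP.≤-refl j)) (top≅P j))) (P≗ (toℕ j)))

mainTheorem5 : (n : ℕ) → 3 ≤ n → (f : BinForm n) → coeff f n ≢ 0ℤ →
    (m : ℕ) → 0 < m → (a b : ℤ) →
    WeaklyDivisible f m a → WeaklyDivisible f m b →
    ((R' f a m ≐ R' f b m) ⇔ (+ m ∣ (a - b)))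
mainTheorem5 (suc (suc (suc N))) (s≤s (s≤s (s≤s z≤n))) f c≢0 (suc m′) (s≤s z≤n) a b _ _ = mk⇔ onlyIf if′
  where
  open Membership f m′
  onlyIf : R' f a m ≐ R' f b m → + m ∣ (a - b)
  onlyIf (_ , R′b⊆R′a) = R′⊆⇒∣ (s≤s z≤n) c≢0 a b R′b⊆R′a
  if′ : + m ∣ (a - b) → R' f a m ≐ R' f b m
  if′ m∣a-b = R′-shift a b m∣a-b , R′-shift b a (subst (m ℕᵈ.∣_) (ℤP.∣i-j∣≡∣j-i∣ a b) m∣a-b)
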